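{- Let $G$ be a graph with property $(*)$. Every coefficient of the dimer face polynomial $D_G(\mathbf y)$ is $0$ or $1$.
   Context: Property $(*)$: $G$ is a finite connected bipartite plane graph with fixed proper black/white coloring and every edge lies in some perfect matching. For a bounded face $f$, an edge is black-white in $f$ if going clockwise around $f$ one meets its black endpoint first, white-black otherwise. If a perfect matching contains all black-white edges of $f$, the down-flip at $f$ replaces them by the white-black edges (inverse: up-flip). Perfect matchings with $M\le M'$ iff $M$ is obtained from $M'$ by down-flips form a distributive lattice with minimum $\hat0$. For a saturated chain $\hat0=M_0\lessdot\cdots\lessdot M_\ell=M$ with $M_{i-1},M_i$ related by a flip at face $f_i$, $\mathrm{mrk}(M)=y_{f_1}\cdots y_{f_\ell}$ (chain-independent). The dimer face polynomial is $D_G=\sum_M\mathrm{mrk}(M)$ over all perfect matchings. -}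

module Defs where

open import Data.Nat using (ℕ; zero; suc; _+_)
open import Data.Fin using (Fin)
open import Data.Bool using (Bool; true; false; not; if_then_else_)
open import Data.Product using (Σ; ∃; _×_; _,_; proj₁; proj₂)
open import Data.Sum using (_⊎_; inj₁; inj₂)
open import Relation.Binary.PropositionalEquality using (_≡_; _≢_)
open import Relation.Nullary using (¬_; yes; no)
import Data.Fin
open import Relation.Binary.Construct.Closure.ReflexiveTransitive using (Star)

iter : {A : Set} → (A → A) → ℕ → A → A
iter f zero    x = x
iter f (suc k) x = f (iter f k x)

-- Finite bipartite plane graphs, encoded combinatorially (rotation
-- system + face labelling + Euler formula + chosen outer face).
--
-- * black vertices Fin nB, white vertices Fin nW (the fixed proper
--   coloring); edges Fin nE, edge e joins black vertex blk e and white
--   vertex wht e (multiple edges allowed).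
-- * darts: (e , false) = e seen from its black end, (e , true) = e seen
--   from its white end ("outgoing" dart).
-- * rot d = next dart counterclockwise around the vertex of d; the darts
--   at each vertex form a single rot-cycle.
-- * the face permutation φ d = rot (rev d) traverses every face with the
--   face on its right, i.e. bounded faces clockwise; face d = the face
--   lying to the right of the outgoing dart d.
-- * Euler's formula V - E + F = 2 forces genus 0 (sphere embedding);
--   the chosen outer face turns it into a plane embedding.

record BipPlaneGraph : Set where
  field
    nB nW nE nF : ℕ
    blk   : Fin nE → Fin nB
    wht   : Fin nE → Fin nW
    rot   : Fin nE × Bool → Fin nE × Bool
    rot⁻¹ : Fin nE × Bool → Fin nE × Bool
    rot-inv₁ : ∀ d → rot (rot⁻¹ d) ≡ d
    rot-inv₂ : ∀ d → rot⁻¹ (rot d) ≡ d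
    face  : Fin nE × Bool → Fin nF
    outer : Fin nF

  Dart : Set
  Dart = Fin nE × Bool

  Vertex : Set
  Vertex = Fin nB ⊎ Fin nW

  vert : Dart → Vertex
  vert d = if proj₂ d then inj₂ (wht (proj₁ d)) else inj₁ (blk (proj₁ d))

  rev : Dart → Dart
  rev d = (proj₁ d , not (proj₂ d))

  φ : Dart → Dart
  φ d = rot (rev d)

  field
    rot-vert   : ∀ d → vert (rot d) ≡ vert d
    rot-cyclic : ∀ d d′ → vert d ≡ vert d′ → ∃ λ k → iter rot k d ≡ d′
    face-φ     : ∀ d → face (φ d) ≡ face d
    face-surj  : ∀ f → ∃ λ d → face d ≡ f
    face-orbit : ∀ d d′ → face d ≡ face d′ → ∃ λ k → iter φ k d ≡ d′
    euler      : nB + nW + nF ≡ nE + 2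

  Adj : Vertex → Vertex → Set
  Adj u v = ∃ λ e → (u ≡ inj₁ (blk e) × v ≡ inj₂ (wht e))
                  ⊎ (u ≡ inj₂ (wht e) × v ≡ inj₁ (blk e))

  Connected : Set
  Connected = ∀ u v → Star Adj u v

  EdgeSet : Set
  EdgeSet = Fin nE → Bool

  IsPerfectMatching : EdgeSet → Set
  IsPerfectMatching M =
      (∀ b → ∃ λ e → M e ≡ true × blk e ≡ b
               × (∀ e′ → M e′ ≡ true → blk e′ ≡ b → e′ ≡ e))
    × (∀ w → ∃ λ e → M e ≡ true × wht e ≡ w
               × (∀ e′ → M e′ ≡ true → wht e′ ≡ w → e′ ≡ e))

  EveryEdgeInPM : Set
  EveryEdgeInPM = ∀ e → ∃ λ M → IsPerfectMatching M × M e ≡ true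

  Bounded : Fin nF → Set
  Bounded f = f ≢ outer

  -- e is black-white in f: going clockwise around f (along φ) one meets
  -- the black endpoint of e first, i.e. the dart of e leaving its black
  -- end has f on its right.
  BW : Fin nF → Fin nE → Set
  BW f e = face (e , false) ≡ f

  WB : Fin nF → Fin nE → Set
  WB f e = face (e , true) ≡ f

  DownFlip : Fin nF → EdgeSet → EdgeSet → Set
  DownFlip f M M′ =
      Bounded f
    × (∀ e → BW f e → M e ≡ true)
    × (∀ e → BW f e → M′ e ≡ false)
    × (∀ e → WB f e → M′ e ≡ true)
    × (∀ e → ¬ BW f e → ¬ WB f e → M′ e ≡ M e)

  DownStep : EdgeSet → EdgeSet → Set
  DownStep M M′ = IsPerfectMatching M × IsPerfectMatching M′
                × ∃ λ f → DownFlip f M M′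

  _≤M_ : EdgeSet → EdgeSet → Set
  M ≤M M′ = IsPerfectMatching M × IsPerfectMatching M′ × Star DownStep M′ M

  IsMinimum : EdgeSet → Set
  IsMinimum z = IsPerfectMatching z × (∀ M → IsPerfectMatching M → z ≤M M)

  -- exponent vectors of monomials in the face variables y_f
  Monomial : Set
  Monomial = Fin nF → ℕ

  unit : Monomial
  unit _ = 0

  bump : Fin nF → Monomial → Monomial
  bump f c g with f Data.Fin.≟ g
  ... | yes _ = suc (c g)
  ... | no  _ = c g

  -- saturated chain z = M₀ ⋖ ⋯ ⋖ M_ℓ = M of up-flips, recording
  -- y_{f₁}⋯y_{f_ℓ}
  data Chain (z : EdgeSet) : EdgeSet → Monomial → Set where
    start : IsPerfectMatching z → Chain z z unit
    step  : ∀ {M M′ c} f → Chain z M c → IsPerfectMatching M′ →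
            DownFlip f M′ M → Chain z M′ (bump f c)

  Mark : EdgeSet → Monomial → Set
  Mark M c = ∃ λ z → IsMinimum z × Σ Monomial λ c′ → Chain z M c′ × (∀ f → c′ f ≡ c f)

  Star-property : Set
  Star-property = Connected × EveryEdgeInPM

{-# OPTIONS --safe #-}
-- Relative to a perfect matching L, a perfect matching U carries a height function h on the
-- faces, vanishing on the outer face, whose jump across an edge e is [e ∈ U] − [e ∈ L]. An
-- up-flip at f raises h by one at f and nowhere else, so along a saturated chain from L the
-- height is exactly the exponent vector of the marking, and the jumps of h recover U edge by
-- edge. It remains to see that the minimum is unique: heights add along z → z′ → z, a height
-- from z to itself has no jumps, hence is zero because the dual graph is connected, and since
-- heights are nonnegative the height from z to z′ vanishes, i.e. z = z′.
module Submission where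

open import Defs
open import Data.Bool using (Bool; true; false)
open import Data.Empty using (⊥-elim)
open import Data.Fin using (Fin; _≟_)
open import Data.Nat using (ℕ; zero; suc; _+_)
open import Data.Nat.Properties
  using (+-assoc; +-comm; +-suc; +-cancelˡ-≡; +-cancelʳ-≡; m+n≡0⇒m≡0; +-commutativeSemigroup)
open import Algebra.Properties.CommutativeSemigroup +-commutativeSemigroup using (x∙yz≈y∙xz)
open import Data.Product using (∃; _×_; _,_; proj₂)
open import Data.Sum using (inj₁; inj₂)
open import Data.Sum.Properties using (inj₁-injective)
open import Relation.Nullary using (¬_; yes; no)
open import Relation.Binary.PropositionalEquality
  using (_≡_; refl; sym; trans; cong; cong₂; subst; _≗_; module ≡-Reasoning)
open import Relation.Binary.Construct.Closure.ReflexiveTransitive using (Star; ε; _◅_)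

χ : Bool → ℕ
χ false = 0
χ true  = 1

χ-injective : ∀ {a b} → χ a ≡ χ b → a ≡ b
χ-injective {false} {false} _ = refl
χ-injective {true}  {true}  _ = refl

+-transport : ∀ {l m u a₁ a₂ b₁ b₂} → l + a₁ ≡ m + a₂ → m + b₁ ≡ u + b₂ →
              l + (a₁ + b₁) ≡ u + (a₂ + b₂)
+-transport {l} {m} {u} {a₁} {a₂} {b₁} {b₂} p q = begin
  l + (a₁ + b₁)   ≡⟨ +-assoc l a₁ b₁ ⟨
  (l + a₁) + b₁   ≡⟨ cong (_+ b₁) (trans p (+-comm m a₂)) ⟩
  (a₂ + m) + b₁   ≡⟨ +-assoc a₂ m b₁ ⟩
  a₂ + (m + b₁)   ≡⟨ cong (a₂ +_) q ⟩
  a₂ + (u + b₂)   ≡⟨ x∙yz≈y∙xz a₂ u b₂ ⟩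
  u + (a₂ + b₂)   ∎
  where open ≡-Reasoning

module _ (G : BipPlaneGraph) where
  open BipPlaneGraph G

  bwFace wbFace : Fin nE → Fin nF
  bwFace e = face (e , false)
  wbFace e = face (e , true)

  bump-other : ∀ {f g} (c : Monomial) → ¬ f ≡ g → bump f c g ≡ c g
  bump-other {f} {g} c f≢g with f ≟ g
  ... | yes f≡g = ⊥-elim (f≢g f≡g)
  ... | no  _   = refl

  record Height (L U : EdgeSet) (h : Monomial) : Set where
    constructor mkHeight
    field
      jump       : ∀ e → χ (L e) + h (bwFace e) ≡ χ (U e) + h (wbFace e)
      outer-zero : h outer ≡ 0

  height-refl : ∀ L → Height L L unit
  height-refl L = mkHeight (λ _ → refl) refl

  height-trans : ∀ {L M U h k} → Height L M h → Height M U k →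
                 Height L U (λ f → h f + k f)
  height-trans {L} {M} {U} {h} (mkHeight jump₁ h-outer) (mkHeight jump₂ k-outer) =
    mkHeight (λ e → +-transport {χ (L e)} {χ (M e)} {χ (U e)} {h (bwFace e)} {h (wbFace e)}
                                (jump₁ e) (jump₂ e))
             (cong₂ _+_ h-outer k-outer)

  height-determines : ∀ {L L′ U U′ h h′} → Height L U h → Height L′ U′ h′ →
                      L ≗ L′ → h ≗ h′ → U ≗ U′
  height-determines {L} {L′} {U} {U′} {h} {h′} (mkHeight jump _) (mkHeight jump′ _) L≗L′ h≗h′ e =
    χ-injective (+-cancelʳ-≡ (h (wbFace e)) (χ (U e)) (χ (U′ e)) (begin
      χ (U e) + h (wbFace e)    ≡⟨ jump e ⟨
      χ (L e) + h (bwFace e)    ≡⟨ cong₂ (λ a x → χ a + x) (L≗L′ e) (h≗h′ (bwFace e)) ⟩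
      χ (L′ e) + h′ (bwFace e)  ≡⟨ jump′ e ⟩
      χ (U′ e) + h′ (wbFace e)  ≡⟨ cong (χ (U′ e) +_) (h≗h′ (wbFace e)) ⟨
      χ (U′ e) + h (wbFace e)   ∎))
    where open ≡-Reasoning

  matched-at-black-unique : ∀ {U e₁ e₂} → IsPerfectMatching U → U e₁ ≡ true → U e₂ ≡ true →
                            blk e₁ ≡ blk e₂ → e₁ ≡ e₂
  matched-at-black-unique {e₂ = e₂} (black-matched , _) e₁∈U e₂∈U same-black
    with black-matched (blk e₂)
  ... | _ , _ , _ , unique = trans (unique _ e₁∈U same-black) (sym (unique e₂ e₂∈U refl))

  rot-black : ∀ e → ∃ λ e′ → rot (e , false) ≡ (e′ , false) × blk e′ ≡ blk e
  rot-black e with rot (e , false) | rot-vert (e , false)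
  ... | e′ , false | same-vertex = e′ , refl , inj₁-injective same-vertex
  ... | _  , true  | ()

  -- The dart following (e , true) around f is a black dart at blk e, so it is black-white in f.
  BW-matched⇒WB-unmatched : ∀ {f U e} → IsPerfectMatching U → (∀ e → BW f e → U e ≡ true) →
                           WB f e → ¬ f ≡ bwFace e → U e ≡ false
  BW-matched⇒WB-unmatched {f} {U} {e} pmU BW⇒U e-WB f≢bwFace with U e in e∈U
  ... | false = refl
  ... | true  with rot-black e
  ...   | e′ , rot≡e′ , blk-e′ = ⊥-elim (f≢bwFace (trans (sym e′-BW) (cong bwFace e′≡e)))
    where
    e′-BW : BW f e′
    e′-BW = trans (cong face (sym rot≡e′)) (trans (face-φ (e , true)) e-WB)
    e′≡e : e′ ≡ e
    e′≡e = matched-at-black-unique pmU (BW⇒U e′ e′-BW) e∈U blk-e′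

  height-upFlip : ∀ {L M U h} f → Height L M h → IsPerfectMatching U → DownFlip f U M →
                  Height L U (bump f h)
  height-upFlip {L} {M} {U} {h} f (mkHeight jump h-outer) pmU
                (f-bounded , BW⇒U , BW⇒¬M , WB⇒M , others) =
    mkHeight jump′ (trans (bump-other h f-bounded) h-outer)
    where
    jump-with : ∀ {e b} → M e ≡ b → χ (L e) + h (bwFace e) ≡ χ b + h (wbFace e)
    jump-with {e} Me≡b = subst (λ b → χ (L e) + h (bwFace e) ≡ χ b + h (wbFace e)) Me≡b (jump e)

    jump′ : ∀ e → χ (L e) + bump f h (bwFace e) ≡ χ (U e) + bump f h (wbFace e)
    -- These two tests are the ones bump performs, so bump f h reduces in every branch.
    jump′ e with f ≟ bwFace e | f ≟ wbFace e
    ... | yes p | yes q with () ← trans (sym (BW⇒¬M e (sym p))) (WB⇒M e (sym q))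
    ... | yes p | no q
      rewrite BW⇒U e (sym p)
      = trans (+-suc (χ (L e)) _) (cong suc (jump-with (BW⇒¬M e (sym p))))
    ... | no p | yes q
      rewrite BW-matched⇒WB-unmatched pmU BW⇒U (sym q) p
      = jump-with (WB⇒M e (sym q))
    ... | no p | no q
      = jump-with (others e (λ e-BW → p (sym e-BW)) (λ e-WB → q (sym e-WB)))

  downSteps-height : ∀ {U L} → Star DownStep U L → ∃ λ h → Height L U h
  downSteps-height {U} ε = unit , height-refl U
  downSteps-height ((pmU , _ , f , flip) ◅ steps) with downSteps-height steps
  ... | h , height = bump f h , height-upFlip f height pmU flip

  chain-height : ∀ {z M c} → Chain z M c → Height z M c
  chain-height {z} (start _)           = height-refl z
  chain-height (step f chain pm flip) = height-upFlip f (chain-height chain) pm flip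

  module _ {A : Set} (s : Fin nF → A) (no-jump : ∀ e → s (bwFace e) ≡ s (wbFace e)) where

    around-rot : ∀ d → s (face (rot d)) ≡ s (face d)
    around-rot (e , false) = trans (cong s (face-φ (e , true))) (sym (no-jump e))
    around-rot (e , true)  = trans (cong s (face-φ (e , false))) (no-jump e)

    around-iter-rot : ∀ k d → s (face (iter rot k d)) ≡ s (face d)
    around-iter-rot zero    d = refl
    around-iter-rot (suc k) d = trans (around-rot (iter rot k d)) (around-iter-rot k d)

    around-vertex : ∀ {d d′} → vert d ≡ vert d′ → s (face d) ≡ s (face d′)
    around-vertex {d} {d′} same-vertex with rot-cyclic d d′ same-vertex
    ... | k , rotᵏd≡d′ = trans (sym (around-iter-rot k d)) (cong (λ x → s (face x)) rotᵏd≡d′)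

    along-path : ∀ {u v} → Star Adj u v → ∀ d d′ → vert d ≡ u → vert d′ ≡ v →
                 s (face d) ≡ s (face d′)
    along-path ε d d′ d-at-u d′-at-u = around-vertex (trans d-at-u (sym d′-at-u))
    along-path ((e , inj₁ (refl , refl)) ◅ path) d d′ d-at-blk d′-at-v =
      trans (around-vertex d-at-blk)
            (trans (no-jump e) (along-path path (e , true) d′ refl d′-at-v))
    along-path ((e , inj₂ (refl , refl)) ◅ path) d d′ d-at-wht d′-at-v =
      trans (around-vertex d-at-wht)
            (trans (sym (no-jump e)) (along-path path (e , false) d′ refl d′-at-v))

    connected⇒faces-constant : Connected → ∀ f g → s f ≡ s g
    connected⇒faces-constant connected f g with face-surj f | face-surj g
    ... | d , refl | d′ , refl = along-path (connected (vert d) (vert d′)) d d′ refl refl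

  height-loop-zero : ∀ {L h} → Connected → Height L L h → ∀ f → h f ≡ 0
  height-loop-zero {L} {h} connected (mkHeight jump h-outer) f =
    trans (connected⇒faces-constant h no-jump connected f outer) h-outer
    where
    no-jump : ∀ e → h (bwFace e) ≡ h (wbFace e)
    no-jump e = +-cancelˡ-≡ (χ (L e)) _ _ (jump e)

  minimum-unique : ∀ {z z′} → Connected → IsMinimum z → IsMinimum z′ → z ≗ z′
  minimum-unique {z} {z′} connected (pm , z-least) (pm′ , z′-least)
    with downSteps-height (proj₂ (proj₂ (z-least z′ pm′)))
       | downSteps-height (proj₂ (proj₂ (z′-least z pm)))
  ... | h , z→z′ | k , z′→z =
    height-determines (height-refl z) z→z′ (λ _ → refl)
                      (λ f → sym (m+n≡0⇒m≡0 (h f) (loop-zero f)))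
    where
    loop-zero : ∀ f → h f + k f ≡ 0
    loop-zero = height-loop-zero connected (height-trans z→z′ z′→z)

corollary2p20 : (G : BipPlaneGraph) → BipPlaneGraph.Star-property G →
    ∀ (M M′ : BipPlaneGraph.EdgeSet G) (c : BipPlaneGraph.Monomial G) →
    BipPlaneGraph.IsPerfectMatching G M → BipPlaneGraph.IsPerfectMatching G M′ →
    BipPlaneGraph.Mark G M c → BipPlaneGraph.Mark G M′ c →
    ∀ e → M e ≡ M′ e
corollary2p20 G (connected , _) M M′ c _ _
              (z , z-min , c₁ , chain , c₁≗c) (z′ , z′-min , c₂ , chain′ , c₂≗c) =
  height-determines G (chain-height G chain) (chain-height G chain′)
    (minimum-unique G connected z-min z′-min) (λ f → trans (c₁≗c f) (sym (c₂≗c f)))
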